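{- Let $d,q\in\mathbb{N}$. The VC-dimension of the edge relation on the Hamming graph $H(d,q)$ is exactly $3$ if and only if at least one of the following holds: (1) $d\ge 3$ and $q\ge 3$; (2) $d\ge 2$ and $q\ge 4$; (3) $d\ge 4$ and $q\ge 2$.
   Context: For $d,q\in\mathbb{N}$ and a set $S$ with $|S|=q$, the Hamming graph $H(d,q)$ has vertex set $S^d$, two vertices being adjacent iff they agree in all but exactly one coordinate. For a graph $G$, $N(v)$ denotes the open neighbourhood of $v$. A set $A\subseteq V(G)$ is shattered by the edge relation if $\{A\cap N(v):v\in V(G)\}$ is the full power set of $A$; the VC-dimension of the edge relation on $G$ is the supremum of sizes of shattered sets. -}

module Defs where

open import Data.Nat using (ℕ; _≤_)
open import Data.Fin using (Fin)
open import Data.Bool using (Bool; true)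
open import Data.Product using (Σ; ∃; _×_)
open import Relation.Binary.PropositionalEquality using (_≡_; _≢_)
open import Function.Bundles using (_⇔_)
open import Function.Definitions using (Injective)

Vertex : ℕ → ℕ → Set
Vertex d q = Fin d → Fin q

Adj : ∀ {d q} → Vertex d q → Vertex d q → Set
Adj {d} u v = Σ (Fin d) λ i → (u i ≢ v i) × (∀ j → j ≢ i → u j ≡ v j)

-- A finite set of n vertices, given by an injective enumeration a : Fin n → Vertex.
-- It is shattered if every subset (a characteristic function on A) equals A ∩ N(v)
-- for some vertex v.
Shattered : ∀ {d q n} → (Fin n → Vertex d q) → Set
Shattered {d} {q} {n} a =
  (f : Fin n → Bool) → ∃ λ (v : Vertex d q) → ∀ i → (Adj v (a i) ⇔ (f i ≡ true))

VCdimEq : ℕ → ℕ → ℕ → Set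
VCdimEq d q k =
  (Σ (Fin k → Vertex d q) λ a → Injective _≡_ _≡_ a × Shattered a)
  × (∀ n (a : Fin n → Vertex d q) → Injective _≡_ _≡_ a → Shattered a → n ≤ k)

-- If v is a common neighbour of four shattered vertices, each of them differs from v in one
-- coordinate. A vertex w ≠ v adjacent to two of them differing from v in distinct coordinates
-- i ≠ j must agree with them at i and j, and then has no further neighbour among the
-- neighbours of v; so a vertex realising three of the four forces all four onto one line
-- through v, and no vertex is adjacent to exactly two points of a line. Hence the
-- VC-dimension is at most 3. Hamming graphs embed as induced subgraphs into larger ones, so
-- shattered triples propagate upwards from H(3,3), H(2,4) and H(4,2), where they are found by
-- search; search also rules them out in H(2,2), H(2,3) and H(3,2), while H(1,q) is complete and
-- H(0,q), H(d,0), H(d,1) have no edges.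
module Submission where

open import Defs
open import Level using (0ℓ)
open import Data.Nat using (ℕ; zero; suc; _+_; _≤_; _≤′_; z≤n; s≤s; ≤′-refl; ≤′-step)
open import Data.Nat.Properties using (≤-trans; ≤⇒≤′; m≤m+n; ≤-refl)
open import Data.Fin using (Fin; zero; suc; _≟_; #_; _↑ˡ_)
open import Data.Fin.Properties using (any?; all?; inject≤-injective; suc-injective; toℕ<n)
open import Data.Bool using (Bool; true; false; not)
import Data.Bool.Properties as Bool
open import Data.Empty using (⊥; ⊥-elim)
open import Data.Product using (Σ; ∃; _×_; _,_; proj₁; proj₂)
open import Data.Sum using (_⊎_; inj₁; inj₂; [_,_])
open import Data.Vec.Functional using ([]; _∷_; head; tail; take; _++_)
open import Data.Vec.Functional.Properties using (lookup-++ˡ)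
import Data.Vec.Functional.Relation.Binary.Pointwise.Properties as Pointwise
open import Function using (_∘_)
open import Function.Bundles using (_⇔_; mk⇔; Equivalence)
open import Function.Definitions using (Injective)
import Function.Properties.Equivalence as ⇔
open import Relation.Binary.Bundles using (Setoid)
open import Relation.Binary.Definitions using (_Respects_)
open import Relation.Binary.PropositionalEquality
  using (_≡_; _≢_; _≗_; refl; sym; trans; cong; cong-app; subst; setoid)
open import Relation.Nullary using (¬_; Dec; yes; no; does)
open import Relation.Nullary.Decidable
  using (map′; ¬?; _×-dec_; _⊎-dec_; _→-dec_; decidable-stable; dec-true; from-yes; from-no)
open import Relation.Unary using (Pred; Decidable)

private
  variable
    d q n d′ q′ d″ q″ : ℕ
    i j k : Fin d
    u v w x y z t : Vertex d q

AgreeOff : Fin d → Vertex d q → Vertex d q → Set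
AgreeOff i u w = ∀ j → j ≢ i → u j ≡ w j

AdjAt : Fin d → Vertex d q → Vertex d q → Set
AdjAt i u w = u i ≢ w i × AgreeOff i u w

agreeOff-sym : AgreeOff i u w → AgreeOff i w u
agreeOff-sym u~w j j≢i = sym (u~w j j≢i)

agreeOff-trans : AgreeOff i u v → AgreeOff i v w → AgreeOff i u w
agreeOff-trans u~v v~w j j≢i = trans (u~v j j≢i) (v~w j j≢i)

agreeOff-ext : AgreeOff i u w → u i ≡ w i → u ≗ w
agreeOff-ext {i = i} u~w uᵢ≡wᵢ j with j ≟ i
... | yes refl = uᵢ≡wᵢ
... | no j≢i = u~w j j≢i

agreeOff₂-ext : i ≢ j → AgreeOff i u w → AgreeOff j u w → u ≗ w
agreeOff₂-ext i≢j u~ᵢw u~ⱼw = agreeOff-ext u~ᵢw (u~ⱼw _ i≢j)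

adj-resp : u ≗ x → w ≗ y → Adj u w → Adj x y
adj-resp u≗x w≗y (i , uᵢ≢wᵢ , u~w) =
  i , (λ xᵢ≡yᵢ → uᵢ≢wᵢ (trans (u≗x i) (trans xᵢ≡yᵢ (sym (w≗y i))))) ,
  λ j j≢i → trans (sym (u≗x j)) (trans (u~w j j≢i) (w≗y j))

adj-respˡ : u ≗ x → Adj u w ⇔ Adj x w
adj-respˡ u≗x = mk⇔ (adj-resp u≗x (λ _ → refl)) (adj-resp (sym ∘ u≗x) (λ _ → refl))

adj-respʳ : w ≗ y → Adj u w ⇔ Adj u y
adj-respʳ w≗y = mk⇔ (adj-resp (λ _ → refl) w≗y) (adj-resp (λ _ → refl) (sym ∘ w≗y))

adj⇒agreeOff : Adj u w → u j ≢ w j → AgreeOff j u w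
adj⇒agreeOff {j = j} (i , _ , u~w) uⱼ≢wⱼ with j ≟ i
... | yes refl = u~w
... | no j≢i = ⊥-elim (uⱼ≢wⱼ (u~w j j≢i))

adj⇒1≤d : Adj {d} u w → 1 ≤ d
adj⇒1≤d (i , _) = ≤-trans (s≤s z≤n) (toℕ<n i)

adj⇒2≤q : Adj {d} {q} u w → 2 ≤ q
adj⇒2≤q {q = zero} {u = u} (i , _) with u i
... | ()
adj⇒2≤q {q = suc zero} {u = u} {w = w} (i , uᵢ≢wᵢ , _) with u i | w i
... | zero | zero = ⊥-elim (uᵢ≢wᵢ refl)
adj⇒2≤q {q = suc (suc q)} _ = s≤s (s≤s z≤n)

adjAt-ext : AdjAt i v x → AgreeOff k v z → z i ≡ x i → z ≗ x
adjAt-ext {i = i} {k = k} (vᵢ≢xᵢ , v~x) v~z zᵢ≡xᵢ with k ≟ i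
... | yes refl = agreeOff-ext (agreeOff-trans (agreeOff-sym v~z) v~x) zᵢ≡xᵢ
... | no k≢i = ⊥-elim (vᵢ≢xᵢ (trans (v~z i (k≢i ∘ sym)) zᵢ≡xᵢ))

adj-neighbour : AgreeOff i v x → Adj w x → AgreeOff i w v ⊎ w i ≡ x i
adj-neighbour {i = i} {x = x} {w = w} v~x w~x with w i ≟ x i
... | yes wᵢ≡xᵢ = inj₂ wᵢ≡xᵢ
... | no wᵢ≢xᵢ = inj₁ (agreeOff-trans (adj⇒agreeOff w~x wᵢ≢xᵢ) (agreeOff-sym v~x))

onLine-¬adj : AgreeOff i w v → AdjAt i v x → ¬ Adj w x → w i ≡ x i
onLine-¬adj {i = i} {w = w} {x = x} w~v (_ , v~x) w≁x with w i ≟ x i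
... | yes wᵢ≡xᵢ = wᵢ≡xᵢ
... | no wᵢ≢xᵢ = ⊥-elim (w≁x (i , wᵢ≢xᵢ , agreeOff-trans w~v v~x))

adj-neighbours-apart : i ≢ j → AdjAt i v x → AdjAt j v y → Adj w x → Adj w y → ¬ w ≗ v →
                       w i ≡ x i × w j ≡ y j
adj-neighbours-apart i≢j (vᵢ≢xᵢ , v~x) (vⱼ≢yⱼ , v~y) w~x w~y w≉v
  with adj-neighbour v~x w~x | adj-neighbour v~y w~y
... | inj₁ w~ᵢv | inj₁ w~ⱼv = ⊥-elim (w≉v (agreeOff₂-ext i≢j w~ᵢv w~ⱼv))
... | inj₁ w~ᵢv | inj₂ wⱼ≡yⱼ = ⊥-elim (vⱼ≢yⱼ (trans (sym (w~ᵢv _ (i≢j ∘ sym))) wⱼ≡yⱼ))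
... | inj₂ wᵢ≡xᵢ | inj₁ w~ⱼv = ⊥-elim (vᵢ≢xᵢ (trans (sym (w~ⱼv _ i≢j)) wᵢ≡xᵢ))
... | inj₂ wᵢ≡xᵢ | inj₂ wⱼ≡yⱼ = wᵢ≡xᵢ , wⱼ≡yⱼ

adj-third-neighbour : i ≢ j → AdjAt i v x → AdjAt j v y → AgreeOff k v z →
                      w i ≡ x i → w j ≡ y j → Adj w z → k ≢ j → z ≗ x
adj-third-neighbour {i = i} {j = j} {z = z} {w = w} i≢j vx (vⱼ≢yⱼ , _) v~z wᵢ≡xᵢ wⱼ≡yⱼ w~z k≢j =
  adjAt-ext vx v~z (trans (sym (adj⇒agreeOff w~z wⱼ≢zⱼ i i≢j)) wᵢ≡xᵢ)
  where
  wⱼ≢zⱼ : w j ≢ z j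
  wⱼ≢zⱼ wⱼ≡zⱼ = vⱼ≢yⱼ (trans (v~z j (k≢j ∘ sym)) (trans (sym wⱼ≡zⱼ) wⱼ≡yⱼ))

adj-three-neighbours : i ≢ j → AdjAt i v x → AdjAt j v y → AgreeOff k v z →
                       Adj w x → Adj w y → Adj w z → ¬ w ≗ v → z ≗ x ⊎ z ≗ y
adj-three-neighbours {j = j} {k = k} i≢j vx vy v~z w~x w~y w~z w≉v
  with adj-neighbours-apart i≢j vx vy w~x w~y w≉v | k ≟ j
... | wᵢ≡xᵢ , wⱼ≡yⱼ | no k≢j = inj₁ (adj-third-neighbour i≢j vx vy v~z wᵢ≡xᵢ wⱼ≡yⱼ w~z k≢j)
... | wᵢ≡xᵢ , wⱼ≡yⱼ | yes refl =
  inj₂ (adj-third-neighbour (i≢j ∘ sym) vy vx v~z wⱼ≡yⱼ wᵢ≡xᵢ w~z (i≢j ∘ sym))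

onLine-¬adj⇒≗ : AgreeOff i w v → AdjAt i v z → AdjAt i v t → ¬ Adj w z → ¬ Adj w t → z ≗ t
onLine-¬adj⇒≗ w~v vz vt w≁z w≁t =
  adjAt-ext vt (proj₂ vz) (trans (sym (onLine-¬adj w~v vz w≁z)) (onLine-¬adj w~v vt w≁t))

collinear-unsplittable : AdjAt i v x → AdjAt i v y → AdjAt i v z → AdjAt i v t →
                         ¬ x ≗ y → ¬ z ≗ t → Adj w x → Adj w y → ¬ Adj w z → ¬ Adj w t → ⊥
collinear-unsplittable vx vy vz vt x≉y z≉t w~x w~y w≁z w≁t
  with adj-neighbour (proj₂ vx) w~x | adj-neighbour (proj₂ vy) w~y
... | inj₁ w~v | _ = z≉t (onLine-¬adj⇒≗ w~v vz vt w≁z w≁t)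
... | inj₂ _ | inj₁ w~v = z≉t (onLine-¬adj⇒≗ w~v vz vt w≁z w≁t)
... | inj₂ wᵢ≡xᵢ | inj₂ wᵢ≡yᵢ = x≉y (adjAt-ext vy (proj₂ vx) (trans (sym wᵢ≡xᵢ) wᵢ≡yᵢ))

ShatteredSet : ℕ → ℕ → ℕ → Set
ShatteredSet d q n = Σ (Fin n → Vertex d q) Shattered

module _ {a : Fin n → Vertex d q} (sh : Shattered a) where

  realiser : (Fin n → Bool) → Vertex d q
  realiser f = proj₁ (sh f)

  sees : ∀ {f k} → f k ≡ true → Adj (realiser f) (a k)
  sees {f} {k} = Equivalence.from (proj₂ (sh f) k)

  misses : ∀ {f k} → f k ≡ false → ¬ Adj (realiser f) (a k)
  misses {f} {k} fₖ≡false w~aₖ with trans (sym fₖ≡false) (Equivalence.to (proj₂ (sh f) k) w~aₖ)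
  ... | ()

  shattered-distinct : ∀ {k l} → k ≢ l → ¬ a k ≗ a l
  shattered-distinct {k} {l} k≢l aₖ≗aₗ
    with l ≟ k | Equivalence.to (proj₂ (sh λ c → does (c ≟ k)) l)
                   (Equivalence.to (adj-respʳ aₖ≗aₗ) (sees (dec-true (k ≟ k) refl)))
  ... | yes l≡k | _ = k≢l (sym l≡k)
  ... | no _ | ()

  shattered⇒injective : Injective _≡_ _≡_ a
  shattered⇒injective {k} {l} aₖ≡aₗ with k ≟ l
  ... | yes k≡l = k≡l
  ... | no k≢l = ⊥-elim (shattered-distinct k≢l (cong-app aₖ≡aₗ))

shattered-resp : {a b : Fin n → Vertex d q} → (∀ k → a k ≗ b k) → Shattered a → Shattered b
shattered-resp a≈b sh f = realiser sh f , λ k → ⇔.trans (⇔.sym (adj-respʳ (a≈b k))) (proj₂ (sh f) k)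

shattered-take : ∀ m {n} {a : Fin (m + n) → Vertex d q} → Shattered a → Shattered (take m a)
shattered-take m {n} {a} sh f =
  realiser sh f′ , λ k → subst (λ b → Adj (realiser sh f′) (a (k ↑ˡ n)) ⇔ (b ≡ true))
                                (lookup-++ˡ f _ k) (proj₂ (sh f′) (k ↑ˡ n))
  where
  f′ : Fin (m + n) → Bool
  f′ = f ++ λ _ → false

no-shattered-quadruple : (b : Fin 4 → Vertex d q) → ¬ Shattered b
no-shattered-quadruple {d} {q} b sh =
  split (dir (# 0) ≟ dir (# 1)) (dir (# 0) ≟ dir (# 2)) (dir (# 0) ≟ dir (# 3))
  where
  all-true : Fin 4 → Bool
  all-true _ = true

  hub : Vertex d q
  hub = realiser sh all-true

  dir : Fin 4 → Fin d
  dir k = proj₁ (sees sh {all-true} {k} refl)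

  neighbour : ∀ k → AdjAt (dir k) hub (b k)
  neighbour k = proj₂ (sees sh {all-true} {k} refl)

  aligned : ∀ k → dir (# 0) ≡ dir k → AdjAt (dir (# 0)) hub (b k)
  aligned k e = subst (λ i → AdjAt i hub (b k)) (sym e) (neighbour k)

  allBut : Fin 4 → Fin 4 → Bool
  allBut n c = not (does (c ≟ n))

  apart : ∀ k l m n → dir k ≢ dir l →
          allBut n k ≡ true → allBut n l ≡ true → allBut n m ≡ true → m ≢ k → m ≢ l → ⊥
  apart k l m n kl-apart fₖ fₗ fₘ m≢k m≢l =
    [ shattered-distinct sh m≢k , shattered-distinct sh m≢l ]
      (adj-three-neighbours kl-apart (neighbour k) (neighbour l) (proj₂ (neighbour m))
        (sees sh fₖ) (sees sh fₗ) (sees sh fₘ) realiser≉hub)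
    where
    realiser≉hub : ¬ realiser sh (allBut n) ≗ hub
    realiser≉hub w≗hub = misses sh (cong not (dec-true (n ≟ n) refl))
                           (adj-resp (sym ∘ w≗hub) (λ _ → refl) (sees sh {all-true} {n} refl))

  split : Dec (dir (# 0) ≡ dir (# 1)) → Dec (dir (# 0) ≡ dir (# 2)) →
          Dec (dir (# 0) ≡ dir (# 3)) → ⊥
  split (no ≢₁) _ _ = apart (# 0) (# 1) (# 2) (# 3) ≢₁ refl refl refl (λ ()) (λ ())
  split (yes _) (no ≢₂) _ = apart (# 0) (# 2) (# 1) (# 3) ≢₂ refl refl refl (λ ()) (λ ())
  split (yes _) (yes _) (no ≢₃) = apart (# 0) (# 3) (# 1) (# 2) ≢₃ refl refl refl (λ ()) (λ ())
  split (yes ≡₁) (yes ≡₂) (yes ≡₃) =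
    collinear-unsplittable
      (neighbour (# 0)) (aligned (# 1) ≡₁) (aligned (# 2) ≡₂) (aligned (# 3) ≡₃)
      (shattered-distinct sh (λ ())) (shattered-distinct sh (λ ()))
      (sees sh {pair} refl) (sees sh {pair} refl) (misses sh {pair} refl) (misses sh {pair} refl)
    where
    pair : Fin 4 → Bool
    pair = true ∷ true ∷ false ∷ false ∷ []

shattered-size≤3 : (a : Fin n → Vertex d q) → Shattered a → n ≤ 3
shattered-size≤3 {n = 0} _ _ = z≤n
shattered-size≤3 {n = 1} _ _ = s≤s z≤n
shattered-size≤3 {n = 2} _ _ = s≤s (s≤s z≤n)
shattered-size≤3 {n = 3} _ _ = ≤-refl
shattered-size≤3 {n = suc (suc (suc (suc n)))} a sh =
  ⊥-elim (no-shattered-quadruple (take 4 a) (shattered-take 4 sh))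

record AdjEmbedding (d q d′ q′ : ℕ) : Set where
  field
    embed : Vertex d q → Vertex d′ q′
    adj-embed : Adj (embed u) (embed w) ⇔ Adj u w

open AdjEmbedding

id-embedding : AdjEmbedding d q d q
id-embedding = record { embed = λ u → u ; adj-embed = ⇔.refl }

_∘-embedding_ : AdjEmbedding d′ q′ d″ q″ → AdjEmbedding d q d′ q′ → AdjEmbedding d q d″ q″
e ∘-embedding e′ = record
  { embed = embed e ∘ embed e′ ; adj-embed = ⇔.trans (adj-embed e) (adj-embed e′) }

alphabet-embedding : {h : Fin q → Fin q′} → Injective _≡_ _≡_ h → AdjEmbedding d q d q′
alphabet-embedding {h = h} h-injective = record { embed = h ∘_ ; adj-embed = mk⇔ reflect preserve }
  where
  reflect : Adj (h ∘ u) (h ∘ w) → Adj u w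
  reflect (i , hᵢ≢ , h~) = i , hᵢ≢ ∘ cong h , λ j j≢i → h-injective (h~ j j≢i)
  preserve : Adj u w → Adj (h ∘ u) (h ∘ w)
  preserve (i , uᵢ≢wᵢ , u~w) = i , uᵢ≢wᵢ ∘ h-injective , λ j j≢i → cong h (u~w j j≢i)

prepend-embedding : Fin q → AdjEmbedding d q (suc d) q
prepend-embedding c = record { embed = c ∷_ ; adj-embed = mk⇔ reflect preserve }
  where
  reflect : Adj (c ∷ u) (c ∷ w) → Adj u w
  reflect (zero , c≢c , _) = ⊥-elim (c≢c refl)
  reflect (suc i , uᵢ≢wᵢ , u~w) = i , uᵢ≢wᵢ , λ j j≢i → u~w (suc j) (j≢i ∘ suc-injective)
  preserve : Adj u w → Adj (c ∷ u) (c ∷ w)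
  preserve (i , uᵢ≢wᵢ , u~w) =
    suc i , uᵢ≢wᵢ , λ { zero _ → refl ; (suc j) j≢i → u~w j (j≢i ∘ cong suc) }

dimension-embedding : Fin q → d ≤′ d′ → AdjEmbedding d q d′ q
dimension-embedding c ≤′-refl = id-embedding
dimension-embedding c (≤′-step d≤′d′) = prepend-embedding c ∘-embedding dimension-embedding c d≤′d′

monotone-embedding : d ≤ d′ → q ≤ q′ → AdjEmbedding d (suc q) d′ (suc q′)
monotone-embedding d≤d′ q≤q′ =
  dimension-embedding zero (≤⇒≤′ d≤d′)
    ∘-embedding alphabet-embedding (inject≤-injective (s≤s q≤q′) (s≤s q≤q′) _ _)

shattered-embed : (e : AdjEmbedding d q d′ q′) {a : Fin n → Vertex d q} →
                  Shattered a → Shattered (embed e ∘ a)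
shattered-embed e sh f = embed e (realiser sh f) , λ k → ⇔.trans (adj-embed e) (proj₂ (sh f) k)

shatteredSet-mono : d ≤ d′ → q ≤ q′ → ShatteredSet d (suc q) n → ShatteredSet d′ (suc q′) n
shatteredSet-mono d≤d′ q≤q′ (a , sh) = embed e ∘ a , shattered-embed e sh
  where
  e : AdjEmbedding _ _ _ _
  e = monotone-embedding d≤d′ q≤q′

-- Vertices are functions, so without function extensionality a search over them can only
-- decide predicates that respect pointwise equality.
Searchable : Setoid 0ℓ 0ℓ → Set₁
Searchable S = ∀ {P : Pred Carrier 0ℓ} → P Respects _≈_ → Decidable P → Dec (∃ P)
  where open Setoid S

searchable-Fin : ∀ n → Searchable (setoid (Fin n))
searchable-Fin n _ = any?

searchable-Bool : Searchable (setoid Bool)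
searchable-Bool _ P? = map′ (λ { (inj₁ p) → true , p ; (inj₂ p) → false , p })
                            (λ { (true , p) → inj₁ p ; (false , p) → inj₂ p })
                            (P? true ⊎-dec P? false)

searchable-Vector : ∀ {S} → Searchable S → ∀ n → Searchable (Pointwise.setoid S n)
searchable-Vector search zero resp P? = map′ ([] ,_) (λ (xs , p) → resp (λ ()) p) (P? [])
searchable-Vector {S} search (suc n) {P} resp P? =
  map′ (λ (x , xs , p) → x ∷ xs , p)
       (λ (xs , p) → head xs , tail xs , resp (λ { zero → ≈-refl ; (suc i) → ≈-refl }) p)
       (search {λ x → ∃ λ xs → P (x ∷ xs)}
               (λ x≈y (xs , p) → xs , resp (λ { zero → x≈y ; (suc i) → ≈-refl }) p)
               (λ x → searchable-Vector {S} search n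
                        (λ xs≈ys → resp (λ { zero → ≈-refl ; (suc i) → xs≈ys i }))
                        (λ xs → P? (x ∷ xs))))
  where open Setoid S using () renaming (refl to ≈-refl)

searchable⇒all? : ∀ {S} → Searchable S → ∀ {P} → P Respects Setoid._≈_ S → Decidable P →
                  Dec (∀ x → P x)
searchable⇒all? {S} search {P} resp P? =
  map′ (λ ∄¬P x → decidable-stable (P? x) (λ ¬Px → ∄¬P (x , ¬Px)))
       (λ ∀P (x , ¬Px) → ¬Px (∀P x))
       (¬? (search {λ x → ¬ P x} (λ x≈y ¬Px Py → ¬Px (resp (Setoid.sym S x≈y) Py)) (¬? ∘ P?)))

Vertices : ℕ → ℕ → Setoid 0ℓ 0ℓ
Vertices d q = Pointwise.setoid (setoid (Fin q)) d

searchable-Vertex : ∀ d q → Searchable (Vertices d q)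
searchable-Vertex d q = searchable-Vector {setoid (Fin q)} (searchable-Fin q) d

_⇔?_ : {A B : Set} → Dec A → Dec B → Dec (A ⇔ B)
A? ⇔? B? = map′ (λ (to , from) → mk⇔ to from) (λ A⇔B → Equivalence.to A⇔B , Equivalence.from A⇔B)
                ((A? →-dec B?) ×-dec (B? →-dec A?))

adj? : (u w : Vertex d q) → Dec (Adj u w)
adj? u w = any? λ i → ¬? (u i ≟ w i) ×-dec all? λ j → ¬? (j ≟ i) →-dec (u j ≟ w j)

shattered? : (a : Fin n → Vertex d q) → Dec (Shattered a)
shattered? {n} {d} {q} a =
  searchable⇒all? {Pointwise.setoid (setoid Bool) n}
    (searchable-Vector {setoid Bool} searchable-Bool n)
    (λ f≗g (w , realises) → w , λ k → subst (λ b → Adj w (a k) ⇔ (b ≡ true)) (f≗g k) (realises k))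
    λ f → searchable-Vertex d q
            (λ u≗w realises k → ⇔.trans (⇔.sym (adj-respˡ u≗w)) (realises k))
            (λ w → all? λ k → adj? w (a k) ⇔? (f k Bool.≟ true))

shatteredSet? : ∀ d q n → Dec (ShatteredSet d q n)
shatteredSet? d q n =
  searchable-Vector {Vertices d q} (searchable-Vertex d q) n shattered-resp shattered?

shatteredTriple-H33 : ShatteredSet 3 3 3
shatteredTriple-H33 = a , from-yes (shattered? a)
  where
  a : Fin 3 → Vertex 3 3
  a = (# 1 ∷ # 0 ∷ # 0 ∷ []) ∷ (# 0 ∷ # 1 ∷ # 0 ∷ []) ∷ (# 0 ∷ # 0 ∷ # 1 ∷ []) ∷ []

shatteredTriple-H24 : ShatteredSet 2 4 3
shatteredTriple-H24 = a , from-yes (shattered? a)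
  where
  a : Fin 3 → Vertex 2 4
  a = (# 0 ∷ # 0 ∷ []) ∷ (# 1 ∷ # 0 ∷ []) ∷ (# 2 ∷ # 0 ∷ []) ∷ []

shatteredTriple-H42 : ShatteredSet 4 2 3
shatteredTriple-H42 = a , from-yes (shattered? a)
  where
  a : Fin 3 → Vertex 4 2
  a = (# 1 ∷ # 0 ∷ # 0 ∷ # 0 ∷ []) ∷
      (# 0 ∷ # 1 ∷ # 0 ∷ # 0 ∷ []) ∷
      (# 0 ∷ # 0 ∷ # 1 ∷ # 0 ∷ []) ∷ []

dim1-¬adj⇒≗ : {u w : Vertex 1 q} → ¬ Adj u w → u ≗ w
dim1-¬adj⇒≗ {u = u} {w} u≁w zero with u zero ≟ w zero
... | yes u₀≡w₀ = u₀≡w₀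
... | no u₀≢w₀ = ⊥-elim (u≁w (zero , u₀≢w₀ , λ { zero 0≢0 → ⊥-elim (0≢0 refl) }))

dim1-no-shattered-pair : (a : Fin (suc (suc n)) → Vertex 1 q) → ¬ Shattered a
dim1-no-shattered-pair a sh =
  shattered-distinct sh {zero} {suc zero} (λ ()) λ c → trans (sym (w≗a zero c)) (w≗a (suc zero) c)
  where
  none : Fin _ → Bool
  none _ = false
  w≗a : ∀ k → realiser sh none ≗ a k
  w≗a k = dim1-¬adj⇒≗ (misses sh {none} {k} refl)

VCdim3Condition : ℕ → ℕ → Set
VCdim3Condition d q = (3 ≤ d × 3 ≤ q) ⊎ ((2 ≤ d × 4 ≤ q) ⊎ (4 ≤ d × 2 ≤ q))

condition⇒shatteredTriple : VCdim3Condition d q → ShatteredSet d q 3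
condition⇒shatteredTriple (inj₁ (3≤d , s≤s 2≤q)) =
  shatteredSet-mono 3≤d 2≤q shatteredTriple-H33
condition⇒shatteredTriple (inj₂ (inj₁ (2≤d , s≤s 3≤q))) =
  shatteredSet-mono 2≤d 3≤q shatteredTriple-H24
condition⇒shatteredTriple (inj₂ (inj₂ (4≤d , s≤s 1≤q))) =
  shatteredSet-mono 4≤d 1≤q shatteredTriple-H42

shatteredTriple⇒condition : ∀ d q → 1 ≤ d → 2 ≤ q → ShatteredSet d q 3 → VCdim3Condition d q
shatteredTriple⇒condition zero _ () _ _
shatteredTriple⇒condition (suc d) zero _ () _
shatteredTriple⇒condition (suc d) (suc zero) _ (s≤s ()) _
shatteredTriple⇒condition 1 (suc (suc q)) _ _ (a , sh) = ⊥-elim (dim1-no-shattered-pair a sh)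
shatteredTriple⇒condition 2 2 _ _ = ⊥-elim ∘ from-no (shatteredSet? 2 2 3)
shatteredTriple⇒condition 2 3 _ _ = ⊥-elim ∘ from-no (shatteredSet? 2 3 3)
shatteredTriple⇒condition 3 2 _ _ = ⊥-elim ∘ from-no (shatteredSet? 3 2 3)
shatteredTriple⇒condition 2 (suc (suc (suc (suc q)))) _ _ _ = inj₂ (inj₁ (≤-refl , m≤m+n 4 q))
shatteredTriple⇒condition 3 (suc (suc (suc q))) _ _ _ = inj₁ (≤-refl , m≤m+n 3 q)
shatteredTriple⇒condition (suc (suc (suc (suc d)))) (suc (suc q)) _ _ _ =
  inj₂ (inj₂ (m≤m+n 4 d , m≤m+n 2 q))

shatteredTriple⇒VCdim3 : ShatteredSet d q 3 → VCdimEq d q 3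
shatteredTriple⇒VCdim3 (a , sh) = (a , shattered⇒injective sh , sh) , λ _ b _ → shattered-size≤3 b

mainTheorem5 : ∀ d q → VCdimEq d q 3 ⇔
    ((3 ≤ d × 3 ≤ q) ⊎ ((2 ≤ d × 4 ≤ q) ⊎ (4 ≤ d × 2 ≤ q)))
mainTheorem5 d q = mk⇔ necessary (shatteredTriple⇒VCdim3 ∘ condition⇒shatteredTriple)
  where
  necessary : VCdimEq d q 3 → VCdim3Condition d q
  necessary ((a , _ , sh) , _) =
    shatteredTriple⇒condition d q (adj⇒1≤d edge) (adj⇒2≤q edge) (a , sh)
    where
    edge : Adj (realiser sh (λ _ → true)) (a zero)
    edge = sees sh {λ _ → true} {zero} refl
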